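{- For every positive integer $m$, $t(I_m, P_mJ_m, (P_mJ_m)^2)=0$.
   Context: $\mathbb{F}_2=\{0,1\}$ is the field with two elements and $\mathbb{F}_2^{m\times m}$ the set of $m\times m$ matrices over $\mathbb{F}_2$; $I_m$ is the identity matrix. For $C_1,\dots,C_s\in\mathbb{F}_2^{m\times m}$, the digital net generated by $(C_1,\dots,C_s)$ is the point set $\{\mathbf{x}_0,\dots,\mathbf{x}_{2^m-1}\}\subset[0,1)^s$ defined as follows: for $0\le l<2^m$ write $l=\iota_0+\iota_1 2+\dots+\iota_{m-1}2^{m-1}$ with $\iota_k\in\mathbb{F}_2$, put $\mathbf{y}_{l,j}=C_j(\iota_0,\dots,\iota_{m-1})^\top\in\mathbb{F}_2^m$ and $\mathbf{x}_l=(\phi(\mathbf{y}_{l,1}),\dots,\phi(\mathbf{y}_{l,s}))$, where $\phi((y_1,\dots,y_m)^\top)=\sum_{k=1}^m y_k 2^{ -k}$. For $0\le t\le m$, a point set $\{\mathbf{x}_0,\dots,\mathbf{x}_{2^m-1}\}\subset[0,1)^s$ is a $(t,m,s)$-net over $\mathbb{F}_2$ if for all nonnegative integers $d_1,\dots,d_s$ with $d_1+\dots+d_s=m-t$, every elementary interval $\prod_{i=1}^s[a_i/2^{d_i},(a_i+1)/2^{d_i})$ with integers $0\le a_i<2^{d_i}$ contains exactly $2^t$ of the points (counted with multiplicity). $t(C_1,\dots,C_s)$ denotes the $t$-value of the digital net generated by $(C_1,\dots,C_s)$, i.e. the least $t$ for which it is a $(t,m,s)$-net over $\mathbb{F}_2$.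 $J_m$ is the $m\times m$ anti-diagonal matrix with all anti-diagonal entries $1$ (and all other entries $0$), and $P_m=\left(\binom{j-1}{i-1} \bmod 2\right)_{i,j=1}^m$ is the upper-triangular Pascal matrix reduced mod $2$. -}

module Defs where

open import Data.Bool using (Bool; true; false; _xor_; _∧_; if_then_else_)
open import Data.Nat using (ℕ; zero; suc; _+_; _*_; _∸_; _^_; _≤_; _<_; _≤ᵇ_; _<ᵇ_; _/_; _%_; _≟_)
open import Data.Nat.Combinatorics using (_C_)
open import Data.Fin using (Fin; toℕ)
import Data.Fin as Fin
open import Data.Vec using (Vec; lookup)
open import Data.List using (List; upTo; map)
open import Data.Nat.ListAction using (sum)
open import Data.Product using (_×_)
open import Relation.Nullary.Decidable using (⌊_⌋)
open import Relation.Binary.PropositionalEquality using (_≡_)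

-- F₂ is modelled by Bool (addition = xor, multiplication = ∧).
Mat : ℕ → Set
Mat m = Fin m → Fin m → Bool

⊕-sum : ∀ {n} → (Fin n → Bool) → Bool
⊕-sum {zero}  f = false
⊕-sum {suc n} f = f Fin.zero xor ⊕-sum (λ k → f (Fin.suc k))

ℕ-sum : ∀ {n} → (Fin n → ℕ) → ℕ
ℕ-sum {zero}  f = 0
ℕ-sum {suc n} f = f Fin.zero + ℕ-sum (λ k → f (Fin.suc k))

_⊗_ : ∀ {m} → Mat m → Mat m → Mat m
(A ⊗ B) i j = ⊕-sum (λ k → A i k ∧ B k j)

I : (m : ℕ) → Mat m
I m i j = ⌊ i Fin.≟ j ⌋

-- anti-diagonal matrix J_m (0-based: entry (i,j) is 1 iff i + j = m - 1)
J : (m : ℕ) → Mat m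
J m i j = ⌊ suc (toℕ i + toℕ j) ≟ m ⌋

-- Pascal matrix mod 2 (0-based: entry (i,j) = binom(j,i) mod 2,
-- i.e. 1-based binom(j-1,i-1) mod 2)
P : (m : ℕ) → Mat m
P m i j = ⌊ (toℕ j C toℕ i) % 2 ≟ 1 ⌋

digit : ℕ → ℕ → Bool
digit l zero    = ⌊ l % 2 ≟ 1 ⌋
digit l (suc k) = digit (l / 2) k

yvec : ∀ {m} → Mat m → ℕ → Fin m → Bool
yvec {m} G l k = ⊕-sum (λ r → G k r ∧ digit l (toℕ r))

-- 2^m · φ(y) = Σ_{k=1}^m y_k 2^{m-k}  (0-based: y k contributes 2^{m-1-k})
scaledφ : ∀ {m} → (Fin m → Bool) → ℕ
scaledφ {m} y = ℕ-sum (λ k → if y k then 2 ^ (m ∸ suc (toℕ k)) else 0)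

-- coordinate j of point x_l is scaledφ(y_{l,j}) / 2^m.
-- x ∈ [a/2^d, (a+1)/2^d)  ⇔  a·2^m ≤ X·2^d < (a+1)·2^m  where x = X/2^m
inInterval : (m X d a : ℕ) → Bool
inInterval m X d a = (a * 2 ^ m ≤ᵇ X * 2 ^ d) ∧ (X * 2 ^ d <ᵇ suc a * 2 ^ m)

allFin : ∀ {s} → (Fin s → Bool) → Bool
allFin {zero}  f = true
allFin {suc s} f = f Fin.zero ∧ allFin (λ i → f (Fin.suc i))

-- number of points x_l (0 ≤ l < 2^m, with multiplicity) of the digital net
-- generated by C in the elementary interval ∏ [a_i/2^{d_i}, (a_i+1)/2^{d_i})
countIn : ∀ {m s} → Vec (Mat m) s → (Fin s → ℕ) → (Fin s → ℕ) → ℕ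
countIn {m} {s} G d a =
  sum (map (λ l → if allFin (λ i → inInterval m (scaledφ (yvec (lookup G i) l)) (d i) (a i))
                  then 1 else 0)
           (upTo (2 ^ m)))

IsDigitalNet : (m : ℕ) {s : ℕ} → Vec (Mat m) s → ℕ → Set
IsDigitalNet m {s} G t =
  t ≤ m ×
  ((d : Fin s → ℕ) → ℕ-sum d ≡ m ∸ t →
   (a : Fin s → ℕ) → ((i : Fin s) → a i < 2 ^ d i) →
   countIn G d a ≡ 2 ^ t)

HasTValue : (m : ℕ) {s : ℕ} → Vec (Mat m) s → ℕ → Set
HasTValue m G t = IsDigitalNet m G t × ((t' : ℕ) → t' < t → IsDigitalNet m G t' → Data.Empty.⊥)
  where import Data.Empty

-- The box ∏ [aᵢ / 2^dᵢ, (aᵢ + 1) / 2^dᵢ) with d₀ + d₁ + d₂ = m contains xₗ exactly when the leading dᵢ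
-- digits of Cᵢ ι(l) spell aᵢ, where ι(l) is the binary digit vector of l. The digit vectors of two points
-- in one box therefore differ by a vector annihilated by the first d₀, d₁, d₂ rows of I, PJ, (PJ)². These
-- m rows are linearly independent, so the two points coincide, and as there are 2^m points and 2^m boxes,
-- every box holds exactly one point. The independence comes from J reversing coordinates, P = (C(j, i)
-- mod 2) being upper unitriangular, and every square window of consecutive columns in the first rows of
-- Pascal's triangle being invertible mod 2, since Pascal's rule reduces it to the unitriangular one.

module Submission where

open import Defs
open import Algebra.Bundles using (CommutativeRing)
import Algebra.Properties.Semiring.Sum as SemiringSum
open import Data.Bool using (Bool; true; false; _xor_; _∧_; if_then_else_; T)
open import Data.Bool.Properties
  using ( xor-∧-commutativeRing; xor-identityʳ; xor-assoc; xor-same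
        ; ∧-assoc; ∧-zeroʳ; ∧-distribˡ-xor; ∧-distribʳ-xor; T-∧ )
open import Data.Fin using (Fin; zero; suc; toℕ; fromℕ<; opposite)
open import Data.Fin.Patterns using (0F; 1F; 2F)
import Data.Fin as Fin
open import Data.Fin.Properties
  using (suc-injective; 0≢1+n; toℕ<n; toℕ-fromℕ<; toℕ-injective; opposite-prop)
open import Data.List using (map; applyUpTo)
import Data.Nat.ListAction as List
open import Data.Nat
  using (ℕ; zero; suc; _+_; _*_; _∸_; _^_; _/_; _%_; _≟_; _≤_; _<_; _<?_; z≤n; s≤s; z<s; NonZero)
open import Data.Nat.Properties hiding (suc-injective; 0≢1+n)
open import Algebra.Properties.CommutativeSemigroup +-commutativeSemigroup using (x∙yz≈y∙xz)
open import Data.Nat.Combinatorics using (_C_; k>n⇒nCk≡0; nCn≡1; nCk+nC[k+1]≡[n+1]C[k+1])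
open import Data.Nat.DivMod using (m%n<n; %-distribˡ-+; m≡m%n+[m/n]*n; m<n*o⇒m/o<n)
open import Data.Nat.Tactic.RingSolver using (solve-∀)
open import Data.Product using (∃-syntax; _×_; _,_; proj₁; proj₂)
open import Data.Unit using (tt)
open import Data.Vec using (Vec; _∷_; []; lookup; tabulate)
open import Data.Vec.Properties using (lookup∘tabulate)
open import Function using (_∘_; id)
open import Function.Bundles using (Equivalence)
open import Relation.Nullary using (Dec; ¬_; yes; no; contradiction)
open import Relation.Nullary.Decidable using (⌊_⌋; isYes≗does; dec-true; dec-false)
open import Relation.Binary.PropositionalEquality
  using (_≡_; _≢_; _≗_; refl; sym; trans; cong; cong₂; subst; module ≡-Reasoning)

module 𝔽₂ = SemiringSum (CommutativeRing.semiring xor-∧-commutativeRing)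
open SemiringSum +-*-semiring using (sum-syntax; sum-cong-≗; ∑-comm; sum-replicate-zero)

infixl 10 ⊕-syntax
⊕-syntax : ∀ n → (Fin n → Bool) → Bool
⊕-syntax _ = 𝔽₂.sum
syntax ⊕-syntax n (λ i → x) = ⊕[ i < n ] x

-- Linear algebra over 𝔽₂

⊕-sum≡⊕ : ∀ {n} (f : Fin n → Bool) → ⊕-sum f ≡ ⊕[ i < n ] f i
⊕-sum≡⊕ {zero}  f = refl
⊕-sum≡⊕ {suc n} f = cong (f zero xor_) (⊕-sum≡⊕ (λ i → f (suc i)))

⊕-vanishing : ∀ {n} {f : Fin n → Bool} → (∀ i → f i ≡ false) → ⊕[ i < n ] f i ≡ false
⊕-vanishing {n} f≡0 = trans (𝔽₂.sum-cong-≗ f≡0) (𝔽₂.sum-replicate-zero n)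

⊕-single : ∀ {n} (f : Fin n → Bool) c → (∀ i → i ≢ c → f i ≡ false) → ⊕[ i < n ] f i ≡ f c
⊕-single f zero f≡0 =
  trans (cong (f zero xor_) (⊕-vanishing (λ i → f≡0 (suc i) λ ()))) (xor-identityʳ (f zero))
⊕-single f (suc c) f≡0 =
  cong₂ _xor_ (f≡0 zero λ ())
              (⊕-single (λ i → f (suc i)) c (λ i i≢c → f≡0 (suc i) (i≢c ∘ suc-injective)))

infixl 7 _·_
_·_ : ∀ {m} → Mat m → (Fin m → Bool) → Fin m → Bool
_·_ {m} A z k = ⊕[ r < m ] (A k r ∧ z r)

·-cong : ∀ {m} (A : Mat m) {z z′ : Fin m → Bool} → z ≗ z′ → A · z ≗ A · z′
·-cong A z≗z′ k = 𝔽₂.sum-cong-≗ (λ r → cong (A k r ∧_) (z≗z′ r))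

·-xor : ∀ {m} (A : Mat m) (u v : Fin m → Bool) →
        A · (λ r → u r xor v r) ≗ λ k → (A · u) k xor (A · v) k
·-xor A u v k = trans (𝔽₂.sum-cong-≗ (λ r → ∧-distribˡ-xor (A k r) (u r) (v r)))
                      (𝔽₂.∑-distrib-+ (λ r → A k r ∧ u r) (λ r → A k r ∧ v r))

·-⊗ : ∀ {m} (A B : Mat m) (z : Fin m → Bool) → (A ⊗ B) · z ≗ A · (B · z)
·-⊗ {m} A B z k = begin
  ⊕[ r < m ] (⊕-sum (λ j → A k j ∧ B j r) ∧ z r)
    ≡⟨ 𝔽₂.sum-cong-≗ (λ r → cong (_∧ z r) (⊕-sum≡⊕ (λ j → A k j ∧ B j r))) ⟩
  ⊕[ r < m ] (⊕[ j < m ] (A k j ∧ B j r) ∧ z r)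
    ≡⟨ 𝔽₂.sum-cong-≗ (λ r → 𝔽₂.*-distribʳ-sum (z r) (λ j → A k j ∧ B j r)) ⟩
  ⊕[ r < m ] ⊕[ j < m ] ((A k j ∧ B j r) ∧ z r)
    ≡⟨ 𝔽₂.sum-cong-≗ (λ r → 𝔽₂.sum-cong-≗ (λ j → ∧-assoc (A k j) (B j r) (z r))) ⟩
  ⊕[ r < m ] ⊕[ j < m ] (A k j ∧ (B j r ∧ z r))
    ≡⟨ 𝔽₂.∑-comm (λ r j → A k j ∧ (B j r ∧ z r)) ⟩
  ⊕[ j < m ] ⊕[ r < m ] (A k j ∧ (B j r ∧ z r))
    ≡⟨ 𝔽₂.sum-cong-≗ (λ j → 𝔽₂.*-distribˡ-sum (A k j) (λ r → B j r ∧ z r)) ⟨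
  ⊕[ j < m ] (A k j ∧ ⊕[ r < m ] (B j r ∧ z r))
    ∎
  where open ≡-Reasoning

⌊⌋-true : ∀ {A : Set} (a? : Dec A) → A → ⌊ a? ⌋ ≡ true
⌊⌋-true a? a = trans (isYes≗does a?) (dec-true a? a)

⌊⌋-false : ∀ {A : Set} (a? : Dec A) → ¬ A → ⌊ a? ⌋ ≡ false
⌊⌋-false a? ¬a = trans (isYes≗does a?) (dec-false a? ¬a)

·-I : ∀ {m} (z : Fin m → Bool) k → (I m · z) k ≡ z k
·-I {m} z k = trans (⊕-single (λ r → I m k r ∧ z r) k off-diagonal)
                    (cong (_∧ z k) (⌊⌋-true (k Fin.≟ k) refl))
  where
  off-diagonal : ∀ r → r ≢ k → I m k r ∧ z r ≡ false
  off-diagonal r r≢k = cong (_∧ z r) (⌊⌋-false (k Fin.≟ r) λ k≡r → r≢k (sym k≡r))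

-- Binomial coefficients mod 2 and windows of Pascal's triangle

𝟙 : Bool → ℕ
𝟙 b = if b then 1 else 0

odd : ℕ → Bool
odd n = ⌊ n % 2 ≟ 1 ⌋

%2≡𝟙odd : ∀ n → n % 2 ≡ 𝟙 (odd n)
%2≡𝟙odd n with n % 2 | m%n<n n 2
... | 0 | _ = refl
... | 1 | _ = refl
... | suc (suc _) | s≤s (s≤s ())

odd-+ : ∀ m n → odd (m + n) ≡ odd m xor odd n
odd-+ m n = begin
  odd (m + n)
    ≡⟨ cong (λ x → ⌊ x ≟ 1 ⌋) (%-distribˡ-+ m n 2) ⟩
  ⌊ (m % 2 + n % 2) % 2 ≟ 1 ⌋
    ≡⟨ cong₂ (λ x y → ⌊ (x + y) % 2 ≟ 1 ⌋) (%2≡𝟙odd m) (%2≡𝟙odd n) ⟩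
  ⌊ (𝟙 (odd m) + 𝟙 (odd n)) % 2 ≟ 1 ⌋
    ≡⟨ parity-of-bits (odd m) (odd n) ⟩
  odd m xor odd n
    ∎
  where
  open ≡-Reasoning
  parity-of-bits : ∀ a b → ⌊ (𝟙 a + 𝟙 b) % 2 ≟ 1 ⌋ ≡ a xor b
  parity-of-bits false false = refl
  parity-of-bits false true  = refl
  parity-of-bits true  false = refl
  parity-of-bits true  true  = refl

infix 8 _C₂_
_C₂_ : ℕ → ℕ → Bool
n C₂ k = odd (n C k)

C₂-above : ∀ {n k} → n < k → n C₂ k ≡ false
C₂-above n<k = cong odd (k>n⇒nCk≡0 n<k)

C₂-diag : ∀ n → n C₂ n ≡ true
C₂-diag n = cong odd (nCn≡1 n)

C₂-suc : ∀ n k → suc n C₂ suc k ≡ n C₂ k xor n C₂ suc k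
C₂-suc n k = trans (cong odd (sym (nCk+nC[k+1]≡[n+1]C[k+1] n k))) (odd-+ (n C k) (n C suc k))

⊕-upTo : ℕ → (ℕ → Bool) → Bool
⊕-upTo n f = ⊕[ j < n ] f (toℕ j)

VanishesOn : (ℕ → Bool) → ℕ → ℕ → Set
VanishesOn w lo hi = ∀ j → lo ≤ j → j < hi → w j ≡ false

vanishesOn-++ : ∀ {w lo mid hi} → VanishesOn w lo mid → VanishesOn w mid hi → VanishesOn w lo hi
vanishesOn-++ {mid = mid} w₁ w₂ j lo≤j j<hi with j <? mid
... | yes j<mid = w₁ j lo≤j j<mid
... | no  j≮mid = w₂ j (≮⇒≥ j≮mid) j<hi

vanishesOn-shift : ∀ {w} a b → VanishesOn (λ i → w (a + i)) 0 b → VanishesOn w a (a + b)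
vanishesOn-shift {w} a b w≡0 j a≤j j<a+b = subst (λ x → w x ≡ false) (m+[n∸m]≡n a≤j)
  (w≡0 (j ∸ a) z≤n (+-cancelˡ-< a (j ∸ a) b (subst (_< a + b) (sym (m+[n∸m]≡n a≤j)) j<a+b)))

⊕-upTo-vanishing : ∀ {n f} → VanishesOn f 0 n → ⊕-upTo n f ≡ false
⊕-upTo-vanishing f≡0 = ⊕-vanishing (λ j → f≡0 (toℕ j) z≤n (toℕ<n j))

⊕-upTo-suc : ∀ n f → ⊕-upTo (suc n) f ≡ ⊕-upTo n f xor f n
⊕-upTo-suc zero    f = xor-identityʳ (f 0)
⊕-upTo-suc (suc n) f =
  trans (cong (f 0 xor_) (⊕-upTo-suc n (λ j → f (suc j)))) (sym (xor-assoc (f 0) _ _))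

⊕-upTo-+ : ∀ a b f → ⊕-upTo (a + b) f ≡ ⊕-upTo a f xor ⊕-upTo b (λ i → f (a + i))
⊕-upTo-+ zero    b f = refl
⊕-upTo-+ (suc a) b f =
  trans (cong (f 0 xor_) (⊕-upTo-+ a b (λ j → f (suc j)))) (sym (xor-assoc (f 0) _ _))

⊕-upTo-window : ∀ {n f} a b → a + b ≤ n → VanishesOn f 0 a → VanishesOn f (a + b) n →
                ⊕-upTo n f ≡ ⊕-upTo b (λ i → f (a + i))
⊕-upTo-window {n} {f} a b a+b≤n f≡0-below f≡0-above = begin
  ⊕-upTo n f
    ≡⟨ cong (λ x → ⊕-upTo x f) n≡a+[b+c] ⟩
  ⊕-upTo (a + (b + c)) f
    ≡⟨ ⊕-upTo-+ a (b + c) f ⟩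
  ⊕-upTo a f xor ⊕-upTo (b + c) f′
    ≡⟨ cong (_xor ⊕-upTo (b + c) f′) (⊕-upTo-vanishing f≡0-below) ⟩
  ⊕-upTo (b + c) f′
    ≡⟨ ⊕-upTo-+ b c f′ ⟩
  ⊕-upTo b f′ xor ⊕-upTo c (λ i → f′ (b + i))
    ≡⟨ cong (⊕-upTo b f′ xor_) (⊕-upTo-vanishing tail≡0) ⟩
  ⊕-upTo b f′ xor false
    ≡⟨ xor-identityʳ (⊕-upTo b f′) ⟩
  ⊕-upTo b f′
    ∎
  where
  open ≡-Reasoning
  f′ = λ i → f (a + i)
  c = n ∸ (a + b)
  n≡a+[b+c] : n ≡ a + (b + c)
  n≡a+[b+c] = trans (sym (m+[n∸m]≡n a+b≤n)) (+-assoc a b c)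
  tail≡0 : VanishesOn (λ i → f′ (b + i)) 0 c
  tail≡0 i _ i<c = f≡0-above (a + (b + i)) (+-monoʳ-≤ a (m≤m+n b i))
    (subst (a + (b + i) <_) (sym n≡a+[b+c]) (+-monoʳ-< a (+-monoʳ-< b i<c)))

pascalWindow : ℕ → ℕ → (ℕ → Bool) → ℕ → Bool
pascalWindow a d c k = ⊕-upTo d (λ i → (a + i) C₂ k ∧ c i)

pascal : ℕ → (ℕ → Bool) → ℕ → Bool
pascal = pascalWindow 0

pascal-injective : ∀ d c → VanishesOn (pascal d c) 0 d → VanishesOn c 0 d
pascal-injective zero    c _      j _ ()
pascal-injective (suc d) c rows≡0 = vanishesOn-++ (pascal-injective d c rows′≡0) last≡0
  where
  open ≡-Reasoning
  row-split : ∀ k → pascal (suc d) c k ≡ pascal d c k xor (d C₂ k ∧ c d)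
  row-split k = ⊕-upTo-suc d (λ i → i C₂ k ∧ c i)
  below-diagonal : pascal d c d ≡ false
  below-diagonal = ⊕-upTo-vanishing {d} {λ i → i C₂ d ∧ c i} λ i _ i<d → cong (_∧ c i) (C₂-above i<d)
  cd≡0 : c d ≡ false
  cd≡0 = begin
    c d                             ≡⟨ cong₂ (λ x y → x xor (y ∧ c d)) below-diagonal (C₂-diag d) ⟨
    pascal d c d xor (d C₂ d ∧ c d) ≡⟨ row-split d ⟨
    pascal (suc d) c d              ≡⟨ rows≡0 d z≤n ≤-refl ⟩
    false                           ∎
  rows′≡0 : VanishesOn (pascal d c) 0 d
  rows′≡0 k _ k<d = begin
    pascal d c k                    ≡⟨ xor-identityʳ (pascal d c k) ⟨
    pascal d c k xor false          ≡⟨ cong (pascal d c k xor_) last-term≡0 ⟨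
    pascal d c k xor (d C₂ k ∧ c d) ≡⟨ row-split k ⟨
    pascal (suc d) c k              ≡⟨ rows≡0 k z≤n (m<n⇒m<1+n k<d) ⟩
    false                           ∎
    where
    last-term≡0 : d C₂ k ∧ c d ≡ false
    last-term≡0 = trans (cong (d C₂ k ∧_) cd≡0) (∧-zeroʳ (d C₂ k))
  last≡0 : VanishesOn c d (suc d)
  last≡0 j d≤j j<1+d rewrite ≤-antisym (≤-pred j<1+d) d≤j = cd≡0

pascalWindow-suc : ∀ a d c k →
  pascalWindow (suc a) d c (suc k) ≡ pascalWindow a d c k xor pascalWindow a d c (suc k)
pascalWindow-suc a d c k = trans (𝔽₂.sum-cong-≗ {d} split) (𝔽₂.∑-distrib-+ {d} (term k) (term (suc k)))
  where
  term : ℕ → Fin d → Bool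
  term k′ j = (a + toℕ j) C₂ k′ ∧ c (toℕ j)
  split : ∀ j → (suc a + toℕ j) C₂ suc k ∧ c (toℕ j) ≡ term k j xor term (suc k) j
  split j = trans (cong (_∧ c (toℕ j)) (C₂-suc (a + toℕ j) k))
                  (∧-distribʳ-xor (c (toℕ j)) ((a + toℕ j) C₂ k) ((a + toℕ j) C₂ suc k))

-- Pascal's rule turns each row of the shifted window into the sum of two consecutive rows of the window.
pascalWindow-shift : ∀ a d c → VanishesOn (pascalWindow (suc a) d c) 0 d → VanishesOn (pascalWindow a d c) 0 d
pascalWindow-shift a d c rows≡0 zero    _ 0<d   = rows≡0 zero z≤n 0<d
pascalWindow-shift a d c rows≡0 (suc k) _ k+1<d = begin
  pascalWindow a d c (suc k)
    ≡⟨ cong (_xor pascalWindow a d c (suc k)) (pascalWindow-shift a d c rows≡0 k z≤n (<-trans (n<1+n k) k+1<d)) ⟨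
  pascalWindow a d c k xor pascalWindow a d c (suc k)
    ≡⟨ pascalWindow-suc a d c k ⟨
  pascalWindow (suc a) d c (suc k)
    ≡⟨ rows≡0 (suc k) z≤n k+1<d ⟩
  false
    ∎
  where open ≡-Reasoning

pascalWindow-injective : ∀ a d c → VanishesOn (pascalWindow a d c) 0 d → VanishesOn c 0 d
pascalWindow-injective zero    d c = pascal-injective d c
pascalWindow-injective (suc a) d c = pascalWindow-injective a d c ∘ pascalWindow-shift a d c

-- Independence of the leading rows of I, PJ and (PJ)²

pascal-vanishes-above : ∀ {m e w} → VanishesOn w e m → VanishesOn (pascal m w) e m
pascal-vanishes-above {m} {e} {w} w≡0 k e≤k _ = ⊕-upTo-vanishing {m} {λ j → j C₂ k ∧ w j} term≡0
  where
  term≡0 : VanishesOn (λ j → j C₂ k ∧ w j) 0 m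
  term≡0 j _ j<m with j <? k
  ... | yes j<k = cong (_∧ w j) (C₂-above j<k)
  ... | no  j≮k = trans (cong (j C₂ k ∧_) (w≡0 j (≤-trans e≤k (≮⇒≥ j≮k)) j<m)) (∧-zeroʳ (j C₂ k))

pascal≡pascalWindow : ∀ {m c} a b → a + b ≤ m → VanishesOn c 0 a → VanishesOn c (a + b) m →
                      ∀ k → pascal m c k ≡ pascalWindow a b (λ i → c (a + i)) k
pascal≡pascalWindow {m} {c} a b a+b≤m c≡0-below c≡0-above k =
  ⊕-upTo-window a b a+b≤m (term≡0 c≡0-below) (term≡0 c≡0-above)
  where
  term≡0 : ∀ {lo hi} → VanishesOn c lo hi → VanishesOn (λ j → j C₂ k ∧ c j) lo hi
  term≡0 c≡0 j lo≤j j<hi = trans (cong (j C₂ k ∧_) (c≡0 j lo≤j j<hi)) (∧-zeroʳ (j C₂ k))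

reverse : ℕ → (ℕ → Bool) → ℕ → Bool
reverse m w n = w (m ∸ suc n)

∸-suc-< : ∀ {m n} → n < m → m ∸ suc n < m
∸-suc-< n<m = ∸-monoʳ-< z<s n<m

∸-suc-involutive : ∀ {m n} → n < m → m ∸ suc (m ∸ suc n) ≡ n
∸-suc-involutive {m} n<m = trans (cong (m ∸_) (sym (+-∸-assoc 1 n<m))) (m∸[m∸n]≡n (<⇒≤ n<m))

reverse-vanishes-prefix : ∀ {m a b w} → m ≡ a + b → VanishesOn w 0 a → VanishesOn (reverse m w) b m
reverse-vanishes-prefix {m} {a} {b} m≡a+b w≡0 j b≤j j<m = w≡0 (m ∸ suc j) z≤n m∸1+j<a
  where
  open ≤-Reasoning
  m∸1+j<a : m ∸ suc j < a
  m∸1+j<a = +-cancelʳ-< (suc j) (m ∸ suc j) a (begin-strict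
    m ∸ suc j + suc j  ≡⟨ m∸n+n≡m j<m ⟩
    m                  ≡⟨ m≡a+b ⟩
    a + b              ≤⟨ +-monoʳ-≤ a b≤j ⟩
    a + j              <⟨ +-monoʳ-< a (n<1+n j) ⟩
    a + suc j          ∎)

reverse-vanishes-suffix : ∀ {m a b w} → m ≡ a + b → VanishesOn w b m → VanishesOn (reverse m w) 0 a
reverse-vanishes-suffix {m} {a} {b} m≡a+b w≡0 j _ j<a =
  w≡0 (m ∸ suc j) (m+n≤o⇒m≤o∸n b b+1+j≤m) (∸-suc-< j<m)
  where
  b+1+j≤m : b + suc j ≤ m
  b+1+j≤m = ≤-trans (+-monoʳ-≤ b j<a) (≤-reflexive (trans (+-comm b a) (sym m≡a+b)))
  j<m : j < m
  j<m = ≤-trans (m≤n+m (suc j) b) b+1+j≤m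

vanishes-of-reverse : ∀ {m w} → VanishesOn (reverse m w) 0 m → VanishesOn w 0 m
vanishes-of-reverse {m} {w} w≡0 j _ j<m =
  subst (λ x → w x ≡ false) (∸-suc-involutive j<m) (w≡0 (m ∸ suc j) z≤n (∸-suc-< j<m))

pascalReverse : ℕ → (ℕ → Bool) → ℕ → Bool
pascalReverse m w = pascal m (reverse m w)

-- Write F = J w, G = P F and K = J G. Then F vanishes on [d₁ + d₂, m), hence so does G, so K vanishes
-- on [0, d₀); by hypothesis G vanishes on [0, d₁), so K also vanishes on [d₀ + d₂, m). The first d₂
-- coordinates of P K therefore only see the window [d₀, d₀ + d₂) of K.
pascalReverse-independent : ∀ {m d₀ d₁ d₂} → d₀ + (d₁ + d₂) ≡ m → ∀ w →
  VanishesOn w 0 d₀ → VanishesOn (pascalReverse m w) 0 d₁ →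
  VanishesOn (pascalReverse m (pascalReverse m w)) 0 d₂ → VanishesOn w 0 m
pascalReverse-independent {m} {d₀} {d₁} {d₂} m≡ w w≡0 PJw≡0 PJ²w≡0 =
  vanishes-of-reverse (pascal-injective m F G≡0)
  where
  F G K : ℕ → Bool
  F = reverse m w
  G = pascal m F
  K = reverse m G
  m≡d₁+[d₀+d₂] : m ≡ d₁ + (d₀ + d₂)
  m≡d₁+[d₀+d₂] = trans (sym m≡) (x∙yz≈y∙xz d₀ d₁ d₂)
  d₀+d₂≤m : d₀ + d₂ ≤ m
  d₀+d₂≤m = ≤-trans (m≤n+m (d₀ + d₂) d₁) (≤-reflexive (sym m≡d₁+[d₀+d₂]))
  K≡0-below : VanishesOn K 0 d₀
  K≡0-below = reverse-vanishes-suffix (sym m≡) (pascal-vanishes-above (reverse-vanishes-prefix (sym m≡) w≡0))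
  K≡0-above : VanishesOn K (d₀ + d₂) m
  K≡0-above = reverse-vanishes-prefix m≡d₁+[d₀+d₂] PJw≡0
  K≡0-window : VanishesOn K d₀ (d₀ + d₂)
  K≡0-window = vanishesOn-shift d₀ d₂ (pascalWindow-injective d₀ d₂ (λ i → K (d₀ + i)) λ k _ k<d₂ →
    trans (sym (pascal≡pascalWindow d₀ d₂ d₀+d₂≤m K≡0-below K≡0-above k)) (PJ²w≡0 k z≤n k<d₂))
  G≡0 : VanishesOn G 0 m
  G≡0 = vanishes-of-reverse (vanishesOn-++ K≡0-below (vanishesOn-++ K≡0-window K≡0-above))

·-J : ∀ {m} (w : ℕ → Bool) k → (J m · (λ r → w (toℕ r))) k ≡ reverse m w (toℕ k)
·-J {m} w k = begin
  (J m · (λ r → w (toℕ r))) k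
    ≡⟨ ⊕-single (λ r → J m k r ∧ w (toℕ r)) (opposite k) off-diagonal ⟩
  J m k (opposite k) ∧ w (toℕ (opposite k))
    ≡⟨ cong₂ _∧_ (⌊⌋-true (suc (toℕ k + toℕ (opposite k)) ≟ m) on-diagonal) (cong w (opposite-prop k)) ⟩
  reverse m w (toℕ k)
    ∎
  where
  open ≡-Reasoning
  on-diagonal : suc (toℕ k + toℕ (opposite k)) ≡ m
  on-diagonal = trans (cong (λ x → suc (toℕ k + x)) (opposite-prop k)) (m+[n∸m]≡n (toℕ<n k))
  off-diagonal : ∀ r → r ≢ opposite k → J m k r ∧ w (toℕ r) ≡ false
  off-diagonal r r≢ = cong (_∧ w (toℕ r)) (⌊⌋-false (suc (toℕ k + toℕ r) ≟ m) λ eq →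
    r≢ (toℕ-injective (trans (sym (m+n∸m≡n (suc (toℕ k)) (toℕ r)))
                             (trans (cong (_∸ suc (toℕ k)) eq) (sym (opposite-prop k))))))

·-PJ : ∀ {m} (w : ℕ → Bool) k → ((P m ⊗ J m) · (λ r → w (toℕ r))) k ≡ pascalReverse m w (toℕ k)
·-PJ {m} w k = trans (·-⊗ (P m) (J m) (λ r → w (toℕ r)) k) (·-cong (P m) (·-J w) k)

·-PJ² : ∀ {m} (w : ℕ → Bool) k →
  (((P m ⊗ J m) ⊗ (P m ⊗ J m)) · (λ r → w (toℕ r))) k ≡ pascalReverse m (pascalReverse m w) (toℕ k)
·-PJ² {m} w k = begin
  (((P m ⊗ J m) ⊗ (P m ⊗ J m)) · (λ r → w (toℕ r))) k
    ≡⟨ ·-⊗ (P m ⊗ J m) (P m ⊗ J m) (λ r → w (toℕ r)) k ⟩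
  ((P m ⊗ J m) · ((P m ⊗ J m) · (λ r → w (toℕ r)))) k
    ≡⟨ ·-cong (P m ⊗ J m) (·-PJ w) k ⟩
  ((P m ⊗ J m) · (λ r → pascalReverse m w (toℕ r))) k
    ≡⟨ ·-PJ (pascalReverse m w) k ⟩
  pascalReverse m (pascalReverse m w) (toℕ k)
    ∎
  where open ≡-Reasoning

-- Vectors of 𝔽₂^m are represented by functions ℕ → Bool, read on [0, m).
LeadingRowsIndependent : (m : ℕ) {s : ℕ} → Vec (Mat m) s → Set
LeadingRowsIndependent m {s} G =
  (d : Fin s → ℕ) → ℕ-sum d ≡ m → (w : ℕ → Bool) →
  ((i : Fin s) (k : Fin m) → toℕ k < d i → (lookup G i · (λ r → w (toℕ r))) k ≡ false) →
  VanishesOn w 0 m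

≤-ℕ-sum : ∀ {s} (d : Fin s → ℕ) i → d i ≤ ℕ-sum d
≤-ℕ-sum d zero    = m≤m+n (d zero) _
≤-ℕ-sum d (suc i) = ≤-trans (≤-ℕ-sum (λ j → d (suc j)) i) (m≤n+m _ (d zero))

ℕ-sum≡⇒≤ : ∀ {s m} (d : Fin s → ℕ) → ℕ-sum d ≡ m → ∀ i → d i ≤ m
ℕ-sum≡⇒≤ d Σd≡m i = ≤-trans (≤-ℕ-sum d i) (≤-reflexive Σd≡m)

vanishing-rows : ∀ {m d} (u : Fin m → Bool) (w : ℕ → Bool) → (∀ k → u k ≡ w (toℕ k)) → d ≤ m →
                 (∀ k → toℕ k < d → u k ≡ false) → VanishesOn w 0 d
vanishing-rows u w u≡w d≤m u≡0 j _ j<d = subst (λ x → w x ≡ false) (toℕ-fromℕ< j<m)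
  (trans (sym (u≡w k)) (u≡0 k (subst (_< _) (sym (toℕ-fromℕ< j<m)) j<d)))
  where
  j<m = <-≤-trans j<d d≤m
  k = fromℕ< j<m

I-PJ-PJ²-leadingRowsIndependent : ∀ m →
  LeadingRowsIndependent m (I m ∷ (P m ⊗ J m) ∷ ((P m ⊗ J m) ⊗ (P m ⊗ J m)) ∷ [])
I-PJ-PJ²-leadingRowsIndependent m d Σd≡m w rows≡0 = pascalReverse-independent m≡ w
  (vanishing-rows _ w (·-I (λ r → w (toℕ r))) (d≤m 0F) (rows≡0 0F))
  (vanishing-rows _ (pascalReverse m w) (·-PJ w) (d≤m 1F) (rows≡0 1F))
  (vanishing-rows _ (pascalReverse m (pascalReverse m w)) (·-PJ² w) (d≤m 2F) (rows≡0 2F))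
  where
  m≡ : d 0F + (d 1F + d 2F) ≡ m
  m≡ = trans (cong (λ x → d 0F + (d 1F + x)) (sym (+-identityʳ (d 2F)))) Σd≡m
  d≤m = ℕ-sum≡⇒≤ d Σd≡m

-- Binary expansions and elementary intervals

digits-injective : ∀ m {l l′} → l < 2 ^ m → l′ < 2 ^ m →
                   (∀ (r : Fin m) → digit l (toℕ r) ≡ digit l′ (toℕ r)) → l ≡ l′
digits-injective zero    (s≤s z≤n) (s≤s z≤n) _ = refl
digits-injective (suc m) {l} {l′} l< l′< same = begin
  l                     ≡⟨ m≡m%n+[m/n]*n l 2 ⟩
  l % 2 + l / 2 * 2     ≡⟨ cong₂ (λ x y → x + y * 2) low-digit high-digits ⟩
  l′ % 2 + l′ / 2 * 2   ≡⟨ m≡m%n+[m/n]*n l′ 2 ⟨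
  l′                    ∎
  where
  open ≡-Reasoning
  half< : ∀ {n} → n < 2 ^ suc m → n / 2 < 2 ^ m
  half< {n} n< = m<n*o⇒m/o<n (subst (n <_) (*-comm 2 (2 ^ m)) n<)
  low-digit : l % 2 ≡ l′ % 2
  low-digit = trans (%2≡𝟙odd l) (trans (cong 𝟙 (same zero)) (sym (%2≡𝟙odd l′)))
  high-digits : l / 2 ≡ l′ / 2
  high-digits = digits-injective m (half< l<) (half< l′<) (λ r → same (suc r))

bit : Bool → ℕ → ℕ
bit b p = if b then p else 0

bit≤ : ∀ b p → bit b p ≤ p
bit≤ true  p = ≤-refl
bit≤ false p = z≤n

bit-*ʳ : ∀ b p q → bit b p * q ≡ bit b (p * q)
bit-*ʳ true  p q = refl
bit-*ʳ false p q = refl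

2^suc : ∀ n → 2 ^ suc n ≡ 2 ^ n + 2 ^ n
2^suc n = cong (2 ^ n +_) (+-identityʳ (2 ^ n))

bit+<2^suc : ∀ b n {u} → u < 2 ^ n → bit b (2 ^ n) + u < 2 ^ suc n
bit+<2^suc b n {u} u< = subst (bit b (2 ^ n) + u <_) (sym (2^suc n)) (+-mono-≤-< (bit≤ b (2 ^ n)) u<)

bit+-injective : ∀ b b′ n {u u′} → u < 2 ^ n → u′ < 2 ^ n →
                 bit b (2 ^ n) + u ≡ bit b′ (2 ^ n) + u′ → b ≡ b′ × u ≡ u′
bit+-injective true  true  n _  _   eq = refl , +-cancelˡ-≡ (2 ^ n) _ _ eq
bit+-injective false false n _  _   eq = refl , eq
bit+-injective true  false n _  u′< eq =
  contradiction (≤-trans (m≤m+n (2 ^ n) _) (≤-reflexive eq)) (<⇒≱ u′<)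
bit+-injective false true  n u< _   eq =
  contradiction (≤-trans (m≤m+n (2 ^ n) _) (≤-reflexive (sym eq))) (<⇒≱ u<)

scaledφ< : ∀ {m} (y : Fin m → Bool) → scaledφ y < 2 ^ m
scaledφ< {zero}  y = s≤s z≤n
scaledφ< {suc m} y = bit+<2^suc (y zero) m (scaledφ< (λ k → y (suc k)))

-- lead d y = ⌊2^d φ(y)⌋ has the binary digits y 0, …, y (d - 1), most significant first.
lead : ∀ {m} → ℕ → (Fin m → Bool) → ℕ
lead {zero}  _       _ = 0
lead {suc m} zero    _ = 0
lead {suc m} (suc d) y = bit (y zero) (2 ^ d) + lead d (λ k → y (suc k))

lead< : ∀ {m} d (y : Fin m → Bool) → lead d y < 2 ^ d
lead< {zero}  d       y = m^n>0 2 d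
lead< {suc m} zero    y = s≤s z≤n
lead< {suc m} (suc d) y = bit+<2^suc (y zero) d (lead< d (λ k → y (suc k)))

lead-injective : ∀ {m} d (y y′ : Fin m → Bool) → lead d y ≡ lead d y′ →
                 ∀ k → toℕ k < d → y k ≡ y′ k
lead-injective {suc m} (suc d) y y′ eq k k<d with bit+-injective (y zero) (y′ zero) d
  (lead< d (λ k → y (suc k))) (lead< d (λ k → y′ (suc k))) eq
lead-injective {suc m} (suc d) y y′ eq zero    _         | y₀≡ , _    = y₀≡
lead-injective {suc m} (suc d) y y′ eq (suc k) (s≤s k<d) | _   , eq′ =
  lead-injective d (λ k → y (suc k)) (λ k → y′ (suc k)) eq′ k k<d

2^d*2^[m∸d] : ∀ {m d} → d ≤ m → 2 ^ d * 2 ^ (m ∸ d) ≡ 2 ^ m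
2^d*2^[m∸d] {m} {d} d≤m = trans (sym (^-distribˡ-+-* 2 d (m ∸ d))) (cong (2 ^_) (m+[n∸m]≡n d≤m))

scaledφ-lead : ∀ {m} d (y : Fin m → Bool) → d ≤ m →
               ∃[ r ] scaledφ y ≡ lead d y * 2 ^ (m ∸ d) + r × r < 2 ^ (m ∸ d)
scaledφ-lead {zero}  zero    y _ = 0 , refl , s≤s z≤n
scaledφ-lead {suc m} zero    y _ = scaledφ y , refl , scaledφ< y
scaledφ-lead {suc m} (suc d) y (s≤s d≤m) with scaledφ-lead d (λ k → y (suc k)) d≤m
... | r , eq , r< = r , eq′ , r<
  where
  open ≡-Reasoning
  t = λ k → y (suc k)
  q = 2 ^ (m ∸ d)
  eq′ : scaledφ y ≡ lead (suc d) y * q + r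
  eq′ = begin
    bit (y zero) (2 ^ m) + scaledφ t
      ≡⟨ cong₂ _+_ (cong (bit (y zero)) (sym (2^d*2^[m∸d] d≤m))) eq ⟩
    bit (y zero) (2 ^ d * q) + (lead d t * q + r)
      ≡⟨ cong (_+ (lead d t * q + r)) (bit-*ʳ (y zero) (2 ^ d) q) ⟨
    bit (y zero) (2 ^ d) * q + (lead d t * q + r)
      ≡⟨ distrib (bit (y zero) (2 ^ d)) (lead d t) q r ⟩
    (bit (y zero) (2 ^ d) + lead d t) * q + r
      ∎
    where
    distrib : ∀ a b q r → a * q + (b * q + r) ≡ (a + b) * q + r
    distrib = solve-∀

inInterval-unique : ∀ m X d {a a′} → T (inInterval m X d a) → T (inInterval m X d a′) → a ≡ a′
inInterval-unique m X d in₁ in₂ = ≤-antisym (≤-of in₁ in₂) (≤-of in₂ in₁)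
  where
  ≤-of : ∀ {a a′} → T (inInterval m X d a) → T (inInterval m X d a′) → a ≤ a′
  ≤-of {a} {a′} in₁ in₂ = ≤-pred (*-cancelʳ-< (2 ^ m) a (suc a′) (≤-<-trans
    (≤ᵇ⇒≤ (a * 2 ^ m) (X * 2 ^ d) (proj₁ (Equivalence.to T-∧ in₁)))
    (<ᵇ⇒< (X * 2 ^ d) (suc a′ * 2 ^ m) (proj₂ (Equivalence.to T-∧ in₂)))))

inInterval-lead : ∀ {m} d (y : Fin m → Bool) → d ≤ m → T (inInterval m (scaledφ y) d (lead d y))
inInterval-lead {m} d y d≤m with scaledφ-lead d y d≤m
... | r , X≡ , r< = Equivalence.from T-∧ (≤⇒≤ᵇ lower , <⇒<ᵇ upper)
  where
  X = scaledφ y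
  L = lead d y
  p = 2 ^ d
  q = 2 ^ (m ∸ d)
  X*p≡ : X * p ≡ L * 2 ^ m + r * p
  X*p≡ = trans (cong (_* p) X≡) (trans (expand L q r p) (cong (λ x → L * x + r * p) (2^d*2^[m∸d] d≤m)))
    where
    expand : ∀ L q r p → (L * q + r) * p ≡ L * (p * q) + r * p
    expand = solve-∀
  instance
    p≢0 : NonZero p
    p≢0 = m^n≢0 2 d
  lower : L * 2 ^ m ≤ X * p
  lower = ≤-trans (m≤m+n (L * 2 ^ m) (r * p)) (≤-reflexive (sym X*p≡))
  upper : X * p < suc L * 2 ^ m
  upper = begin-strict
    X * p                ≡⟨ X*p≡ ⟩
    L * 2 ^ m + r * p    <⟨ +-monoʳ-< (L * 2 ^ m) r*p<2^m ⟩
    L * 2 ^ m + 2 ^ m    ≡⟨ +-comm (L * 2 ^ m) (2 ^ m) ⟩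
    suc L * 2 ^ m        ∎
    where
    open ≤-Reasoning
    r*p<2^m : r * p < 2 ^ m
    r*p<2^m = subst (r * p <_) (trans (*-comm q p) (2^d*2^[m∸d] d≤m)) (*-monoˡ-< p r<)

-- Counting points in boxes

𝟙-T : ∀ {b} → T b → 𝟙 b ≡ 1
𝟙-T {true} _ = refl

𝟙-¬T : ∀ {b} → ¬ T b → 𝟙 b ≡ 0
𝟙-¬T {true}  ¬t = contradiction tt ¬t
𝟙-¬T {false} _  = refl

∑-const : ∀ n c → ∑[ i < n ] c ≡ n * c
∑-const zero    c = refl
∑-const (suc n) c = cong (c +_) (∑-const n c)

∑-mono-≤ : ∀ {n} {f g : Fin n → ℕ} → (∀ i → f i ≤ g i) → ∑[ i < n ] f i ≤ ∑[ i < n ] g i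
∑-mono-≤ {zero}  _   = z≤n
∑-mono-≤ {suc n} f≤g = +-mono-≤ (f≤g zero) (∑-mono-≤ (λ i → f≤g (suc i)))

+-tight : ∀ {a b c d} → a ≤ c → b ≤ d → a + b ≡ c + d → a ≡ c × b ≡ d
+-tight {a} {b} {c} {d} a≤c b≤d eq = a≡c , +-cancelˡ-≡ a b d (trans eq (cong (_+ d) (sym a≡c)))
  where
  a≡c : a ≡ c
  a≡c = ≤-antisym a≤c (+-cancelʳ-≤ d c a (≤-trans (≤-reflexive (sym eq)) (+-monoʳ-≤ a b≤d)))

∑-tight : ∀ {n} {f g : Fin n → ℕ} → (∀ i → f i ≤ g i) → ∑[ i < n ] f i ≡ ∑[ i < n ] g i →
          ∀ i → f i ≡ g i
∑-tight {suc n} f≤g eq zero    = proj₁ (+-tight (f≤g zero) (∑-mono-≤ (λ i → f≤g (suc i))) eq)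
∑-tight {suc n} f≤g eq (suc i) =
  ∑-tight (λ i → f≤g (suc i)) (proj₂ (+-tight (f≤g zero) (∑-mono-≤ (λ i → f≤g (suc i))) eq)) i

∑-𝟙-none : ∀ {n} (f : Fin n → Bool) → (∀ i → ¬ T (f i)) → ∑[ i < n ] 𝟙 (f i) ≡ 0
∑-𝟙-none {n} f none = trans (sum-cong-≗ (λ i → 𝟙-¬T (none i))) (sum-replicate-zero n)

∑-𝟙-≤1 : ∀ {n} (f : Fin n → Bool) → (∀ i j → T (f i) → T (f j) → i ≡ j) →
         ∑[ i < n ] 𝟙 (f i) ≤ 1
∑-𝟙-≤1 {zero}  f _    = z≤n
∑-𝟙-≤1 {suc n} f uniq with f zero in f₀≡
... | true  = ≤-reflexive (cong suc (∑-𝟙-none (λ i → f (suc i)) λ i t →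
                0≢1+n (uniq zero (suc i) (subst T (sym f₀≡) tt) t)))
... | false = ∑-𝟙-≤1 (λ i → f (suc i)) λ i j tᵢ tⱼ → suc-injective (uniq (suc i) (suc j) tᵢ tⱼ)

∑-𝟙-unique : ∀ {n} (f : Fin n → Bool) c → T (f c) → (∀ i → T (f i) → i ≡ c) →
             ∑[ i < n ] 𝟙 (f i) ≡ 1
∑-𝟙-unique f zero    t uniq =
  cong₂ _+_ (𝟙-T t) (∑-𝟙-none (λ i → f (suc i)) λ i tᵢ → 0≢1+n (sym (uniq (suc i) tᵢ)))
∑-𝟙-unique f (suc c) t uniq =
  cong₂ _+_ (𝟙-¬T λ t₀ → 0≢1+n (uniq zero t₀))
            (∑-𝟙-unique (λ i → f (suc i)) c t λ i tᵢ → suc-injective (uniq (suc i) tᵢ))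

sum-map-applyUpTo : ∀ (f g : ℕ → ℕ) n → List.sum (map f (applyUpTo g n)) ≡ ∑[ i < n ] f (g (toℕ i))
sum-map-applyUpTo f g zero    = refl
sum-map-applyUpTo f g (suc n) = cong (f (g 0) +_) (sum-map-applyUpTo f (λ i → g (suc i)) n)

InGrid : ∀ {s} → (Fin s → ℕ) → Vec ℕ s → Set
InGrid d v = ∀ i → lookup v i < 2 ^ d i

-- Boxes are indexed by vectors rather than functions, so that every box is literally of the form x ∷ v.
∑grid : ∀ {s} → (Fin s → ℕ) → (Vec ℕ s → ℕ) → ℕ
∑grid {zero}  d F = F []
∑grid {suc s} d F = ∑[ j < 2 ^ d zero ] ∑grid (λ i → d (suc i)) (λ v → F (toℕ j ∷ v))

inGrid-∷ : ∀ {s} (d : Fin (suc s) → ℕ) (j : Fin (2 ^ d zero)) {v} →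
           InGrid (λ i → d (suc i)) v → InGrid d (toℕ j ∷ v)
inGrid-∷ d j v∈ zero    = toℕ<n j
inGrid-∷ d j v∈ (suc i) = v∈ i

∑grid-1 : ∀ {s} (d : Fin s → ℕ) → ∑grid d (λ _ → 1) ≡ 2 ^ ℕ-sum d
∑grid-1 {zero}  d = refl
∑grid-1 {suc s} d = begin
  ∑[ j < 2 ^ d zero ] ∑grid d′ (λ _ → 1)   ≡⟨ sum-cong-≗ {2 ^ d zero} (λ _ → ∑grid-1 d′) ⟩
  ∑[ j < 2 ^ d zero ] (2 ^ ℕ-sum d′)       ≡⟨ ∑-const (2 ^ d zero) (2 ^ ℕ-sum d′) ⟩
  2 ^ d zero * 2 ^ ℕ-sum d′                ≡⟨ ^-distribˡ-+-* 2 (d zero) (ℕ-sum d′) ⟨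
  2 ^ ℕ-sum d                              ∎
  where
  open ≡-Reasoning
  d′ = λ i → d (suc i)

∑grid-0 : ∀ {s} (d : Fin s → ℕ) → ∑grid d (λ _ → 0) ≡ 0
∑grid-0 {zero}  d = refl
∑grid-0 {suc s} d =
  trans (sum-cong-≗ {2 ^ d zero} (λ _ → ∑grid-0 (λ i → d (suc i)))) (sum-replicate-zero (2 ^ d zero))

∑grid-comm : ∀ {s n} (d : Fin s → ℕ) (F : Fin n → Vec ℕ s → ℕ) →
             ∑grid d (λ v → ∑[ l < n ] F l v) ≡ ∑[ l < n ] ∑grid d (F l)
∑grid-comm {zero}  d F = refl
∑grid-comm {suc s} {n} d F =
  trans (sum-cong-≗ {2 ^ d zero} λ j → ∑grid-comm (λ i → d (suc i)) (λ l v → F l (toℕ j ∷ v)))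
        (∑-comm {2 ^ d zero} {n} λ j l → ∑grid (λ i → d (suc i)) (λ v → F l (toℕ j ∷ v)))

∑grid-mono : ∀ {s} (d : Fin s → ℕ) {F H : Vec ℕ s → ℕ} →
             (∀ v → InGrid d v → F v ≤ H v) → ∑grid d F ≤ ∑grid d H
∑grid-mono {zero}  d F≤H = F≤H [] λ ()
∑grid-mono {suc s} d F≤H =
  ∑-mono-≤ λ j → ∑grid-mono (λ i → d (suc i)) λ v v∈ → F≤H (toℕ j ∷ v) (inGrid-∷ d j v∈)

∑grid-tight : ∀ {s} (d : Fin s → ℕ) {F H : Vec ℕ s → ℕ} → (∀ v → InGrid d v → F v ≤ H v) →
              ∑grid d F ≡ ∑grid d H → ∀ v → InGrid d v → F v ≡ H v
∑grid-tight {zero}  d F≤H eq [] _ = eq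
∑grid-tight {suc s} d {F} {H} F≤H eq (x ∷ v) x∷v∈ =
  subst (λ y → F (y ∷ v) ≡ H (y ∷ v)) (toℕ-fromℕ< (x∷v∈ zero))
    (∑grid-tight d′ (λ w w∈ → F≤H (toℕ j ∷ w) (inGrid-∷ d j w∈)) (slices≡ j) v (λ i → x∷v∈ (suc i)))
  where
  d′ = λ i → d (suc i)
  j = fromℕ< (x∷v∈ zero)
  slices≡ : ∀ j → ∑grid d′ (λ w → F (toℕ j ∷ w)) ≡ ∑grid d′ (λ w → H (toℕ j ∷ w))
  slices≡ = ∑-tight (λ j → ∑grid-mono d′ λ w w∈ → F≤H (toℕ j ∷ w) (inGrid-∷ d j w∈)) eq

∑grid-allFin : ∀ {s} (d : Fin s → ℕ) (Q : Fin s → ℕ → Bool) →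
               (∀ i → ∑[ j < 2 ^ d i ] 𝟙 (Q i (toℕ j)) ≡ 1) →
               ∑grid d (λ v → 𝟙 (allFin (λ i → Q i (lookup v i)))) ≡ 1
∑grid-allFin {zero}  d Q _   = refl
∑grid-allFin {suc s} d Q one =
  trans (sum-cong-≗ {2 ^ d zero} λ j → slice (Q zero (toℕ j))) (one zero)
  where
  d′ = λ i → d (suc i)
  rest = λ v → allFin (λ i → Q (suc i) (lookup v i))
  slice : ∀ b → ∑grid d′ (λ v → 𝟙 (b ∧ rest v)) ≡ 𝟙 b
  slice true  = ∑grid-allFin d′ (λ i → Q (suc i)) (λ i → one (suc i))
  slice false = ∑grid-0 d′

double-counting : ∀ {s n} (d : Fin s → ℕ) (Mem : Fin n → Vec ℕ s → Bool) → n ≡ 2 ^ ℕ-sum d →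
  (∀ l → ∑grid d (λ v → 𝟙 (Mem l v)) ≡ 1) →
  (∀ v → InGrid d v → ∑[ l < n ] 𝟙 (Mem l v) ≤ 1) →
  ∀ v → InGrid d v → ∑[ l < n ] 𝟙 (Mem l v) ≡ 1
double-counting {n = n} d Mem n≡ one-box at-most-one = ∑grid-tight d at-most-one (begin
  ∑grid d (λ v → ∑[ l < n ] 𝟙 (Mem l v))   ≡⟨ ∑grid-comm d (λ l v → 𝟙 (Mem l v)) ⟩
  ∑[ l < n ] ∑grid d (λ v → 𝟙 (Mem l v))   ≡⟨ sum-cong-≗ one-box ⟩
  ∑[ l < n ] 1                             ≡⟨ ∑-const n 1 ⟩
  n * 1                                    ≡⟨ *-identityʳ n ⟩
  n                                        ≡⟨ n≡ ⟩
  2 ^ ℕ-sum d                              ≡⟨ ∑grid-1 d ⟨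
  ∑grid d (λ _ → 1)                        ∎)
  where open ≡-Reasoning

allFin-cong : ∀ {s} {f g : Fin s → Bool} → (∀ i → f i ≡ g i) → allFin f ≡ allFin g
allFin-cong {zero}  _   = refl
allFin-cong {suc s} f≡g = cong₂ _∧_ (f≡g zero) (allFin-cong (λ i → f≡g (suc i)))

T-allFin : ∀ {s} {f : Fin s → Bool} → T (allFin f) → ∀ i → T (f i)
T-allFin {suc s} t zero    = proj₁ (Equivalence.to T-∧ t)
T-allFin {suc s} t (suc i) = T-allFin (proj₂ (Equivalence.to T-∧ t)) i

-- The linear independence criterion

xor≡false⇒≡ : ∀ a b → a xor b ≡ false → a ≡ b
xor≡false⇒≡ false false _ = refl
xor≡false⇒≡ true  true  _ = refl

inInterval⇒lead≡ : ∀ {m} d (y : Fin m → Bool) a → d ≤ m →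
                   T (inInterval m (scaledφ y) d a) → lead d y ≡ a
inInterval⇒lead≡ {m} d y a d≤m = inInterval-unique m (scaledφ y) d (inInterval-lead d y d≤m)

∑-inInterval≡1 : ∀ {m} d (y : Fin m → Bool) → d ≤ m →
                 ∑[ j < 2 ^ d ] 𝟙 (inInterval m (scaledφ y) d (toℕ j)) ≡ 1
∑-inInterval≡1 {m} d y d≤m = ∑-𝟙-unique (λ j → inInterval m (scaledφ y) d (toℕ j)) c
  (subst (λ a → T (inInterval m (scaledφ y) d a)) (sym c≡lead) (inInterval-lead d y d≤m))
  (λ j t → toℕ-injective (trans (sym (inInterval⇒lead≡ d y (toℕ j) d≤m t)) (sym c≡lead)))
  where
  c = fromℕ< (lead< d y)
  c≡lead : toℕ c ≡ lead d y
  c≡lead = toℕ-fromℕ< (lead< d y)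

same-box⇒≡ : ∀ {m s} (G : Vec (Mat m) s) → LeadingRowsIndependent m G →
  ∀ d → ℕ-sum d ≡ m → (a : Fin s → ℕ) → ∀ {l l′} → l < 2 ^ m → l′ < 2 ^ m →
  (∀ i → T (inInterval m (scaledφ (yvec (lookup G i) l)) (d i) (a i))) →
  (∀ i → T (inInterval m (scaledφ (yvec (lookup G i) l′)) (d i) (a i))) → l ≡ l′
same-box⇒≡ {m} {s} G independent d Σd≡m a {l} {l′} l< l′< in-box in-box′ =
  digits-injective m l< l′< λ r →
    xor≡false⇒≡ (digit l (toℕ r)) (digit l′ (toℕ r))
                (independent d Σd≡m w rows≡0 (toℕ r) z≤n (toℕ<n r))
  where
  w : ℕ → Bool
  w j = digit l j xor digit l′ j
  y y′ : Fin s → Fin m → Bool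
  y  i = yvec (lookup G i) l
  y′ i = yvec (lookup G i) l′
  leading-digits-agree : ∀ i k → toℕ k < d i → y i k ≡ y′ i k
  leading-digits-agree i = lead-injective (d i) (y i) (y′ i) (trans
    (inInterval⇒lead≡ (d i) (y i) (a i) (ℕ-sum≡⇒≤ d Σd≡m i) (in-box i))
    (sym (inInterval⇒lead≡ (d i) (y′ i) (a i) (ℕ-sum≡⇒≤ d Σd≡m i) (in-box′ i))))
  rows≡0 : ∀ i k → toℕ k < d i → (lookup G i · (λ r → w (toℕ r))) k ≡ false
  rows≡0 i k k<d = begin
    (lookup G i · (λ r → w (toℕ r))) k
      ≡⟨ ·-xor (lookup G i) (λ r → digit l (toℕ r)) (λ r → digit l′ (toℕ r)) k ⟩
    (lookup G i · (λ r → digit l (toℕ r))) k xor (lookup G i · (λ r → digit l′ (toℕ r))) k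
      ≡⟨ cong₂ _xor_ (⊕-sum≡⊕ (λ r → lookup G i k r ∧ digit l (toℕ r)))
                     (⊕-sum≡⊕ (λ r → lookup G i k r ∧ digit l′ (toℕ r))) ⟨
    y i k xor y′ i k
      ≡⟨ cong (_xor y′ i k) (leading-digits-agree i k k<d) ⟩
    y′ i k xor y′ i k
      ≡⟨ xor-same (y′ i k) ⟩
    false ∎
    where open ≡-Reasoning

countIn≡1 : ∀ {m s} (G : Vec (Mat m) s) → LeadingRowsIndependent m G →
  ∀ d → ℕ-sum d ≡ m → ∀ a → (∀ i → a i < 2 ^ d i) → countIn G d a ≡ 1
countIn≡1 {m} {s} G independent d Σd≡m a a< = begin
  countIn G d a
    ≡⟨ sum-map-applyUpTo (λ l → 𝟙 (inBox l a)) id (2 ^ m) ⟩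
  ∑[ l < 2 ^ m ] 𝟙 (inBox (toℕ l) a)
    ≡⟨ sum-cong-≗ {2 ^ m} (λ l → cong 𝟙 (allFin-cong λ i →
         cong (inInterval m (x (toℕ l) i) (d i)) (lookup∘tabulate a i))) ⟨
  ∑[ l < 2 ^ m ] 𝟙 (Mem l (tabulate a))
    ≡⟨ double-counting d Mem (cong (2 ^_) (sym Σd≡m)) in-one-box at-most-one (tabulate a)
         (λ i → subst (_< 2 ^ d i) (sym (lookup∘tabulate a i)) (a< i)) ⟩
  1
    ∎
  where
  open ≡-Reasoning
  x : ℕ → Fin s → ℕ
  x l i = scaledφ (yvec (lookup G i) l)
  inBox : ℕ → (Fin s → ℕ) → Bool
  inBox l b = allFin (λ i → inInterval m (x l i) (d i) (b i))
  Mem : Fin (2 ^ m) → Vec ℕ s → Bool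
  Mem l v = inBox (toℕ l) (lookup v)
  in-one-box : ∀ l → ∑grid d (λ v → 𝟙 (Mem l v)) ≡ 1
  in-one-box l = ∑grid-allFin d (λ i → inInterval m (x (toℕ l) i) (d i)) λ i →
    ∑-inInterval≡1 (d i) (yvec (lookup G i) (toℕ l)) (ℕ-sum≡⇒≤ d Σd≡m i)
  at-most-one : ∀ v → InGrid d v → ∑[ l < 2 ^ m ] 𝟙 (Mem l v) ≤ 1
  at-most-one v _ = ∑-𝟙-≤1 (λ l → Mem l v) λ l l′ t t′ → toℕ-injective
    (same-box⇒≡ G independent d Σd≡m (lookup v) (toℕ<n l) (toℕ<n l′) (T-allFin t) (T-allFin t′))

leadingRowsIndependent⇒net : ∀ {m s} (G : Vec (Mat m) s) → LeadingRowsIndependent m G →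
                             IsDigitalNet m G 0
leadingRowsIndependent⇒net G independent = z≤n , countIn≡1 G independent

lemma7 : (m : ℕ) → 1 ≤ m →
    HasTValue m (I m ∷ (P m ⊗ J m) ∷ ((P m ⊗ J m) ⊗ (P m ⊗ J m)) ∷ []) 0
lemma7 m _ =
  leadingRowsIndependent⇒net (I m ∷ (P m ⊗ J m) ∷ ((P m ⊗ J m) ⊗ (P m ⊗ J m)) ∷ [])
                             (I-PJ-PJ²-leadingRowsIndependent m) ,
  λ _ ()
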